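{- Let $\sigma$ be a finite or countable signature. Any scheme of computation tree $S_1=(n,G_1)\in\mathrm{Tree}(\sigma)$ can be transformed by changing of variables into a scheme of computation tree $S_2=(n,G_2)\in\mathrm{Tree}(\sigma)$ that is equivalent to $S_1$ and in which all variables in function and predicate expressions belong to the set $X_{n+2^{h(S_1)}}$.
   Context: Notation: $\omega=\{0,1,2,\dots\}$, variables $X=\{x_i:i\in\omega\}$, $X_n=\{x_0,\dots,x_{n-1}\}$; $\alpha^1=\alpha$, $\alpha^0=\neg\alpha$. A function expression is $x_j\Leftarrow f(x_{l_1},\dots,x_{l_m})$ ($f$ an $m$-ary function symbol of $\sigma$); an (equality-free) predicate expression is $r(x_{l_1},\dots,x_{l_k})$ ($r$ a $k$-ary predicate symbol). For $n\ge1$ and a sequence $\beta=\beta_1,\dots,\beta_m$ of expressions define term sequences $M_i=(t_{i0},t_{i1},\dots)$: $M_1=(x_0,\dots,x_{n-1},x_{n-1},\dots)$; $M_{i+1}=M_i$ if $\beta_i$ is a predicate expression; if $\beta_i$ is $x_j\Leftarrow f(x_{l_1},\dots,x_{l_m})$, $M_{i+1}$ is $M_i$ with $t_{ij}$ replaced by $f(t_{il_1},\dots,t_{il_m})$. For predicate $\beta_i=r(x_{l_1},\dots,x_{l_k})$, $\kappa(n,\beta,\beta_i)=r(t_{il_1},\dots,t_{il_k})$. $\mathrm{Tree}(\sigma)$: schemes $S=(n,G)$, $n\ge1$, $G$ a finite rooted directed tree with function nodes (labeled by a function expression, one outgoing edge), predicate nodes (labeled by an equality-free predicate expression, two outgoing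 edges labeled $0,1$), terminal nodes (labeled by numbers in $\omega$). For a complete path $\tau=w_1,d_1,\dots,w_m,d_m,w_{m+1}$ (root to terminal node) with expressions $\beta=\beta_1,\dots,\beta_m$, $F(\tau)$ is the set of $\kappa(n,\beta,\beta_i)^c$ over predicate nodes $w_i$, $c$ the label of $d_i$ (a tautology if none), $t_\tau$ the terminal label. For a structure $U$ with universe $A$, the computation tree $(S,U)$ implements $\varphi_{(S,U)}:A^n\to\omega$, $\varphi_{(S,U)}(\bar a)=t_\tau$ for the unique complete path $\tau$ all of whose formulas in $F(\tau)$ are true in $U$ on $\bar a$. $h(S)$ (depth) is the maximum number of non-terminal nodes on a complete path of $S$. Two schemes $S_1=(n,G_1)$, $S_2=(n,G_2)$ are equivalent if $\varphi_{(S_1,U)}=\varphi_{(S_2,U)}$ for every structure $U$ of $\sigma$. "Changing of variables" means $G_2$ is obtained from $G_1$ by replacing variables in the expressions labeling nodes (the tree structure and terminal labels are unchanged). -}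

module Defs where

open import Data.Nat using (ℕ; zero; suc; _+_; _^_; _≤_; _<_; _<?_; _≡ᵇ_; _⊔_; _∸_; s≤s; z≤n)
open import Data.Bool using (Bool; true; false; if_then_else_)
open import Data.Fin using (Fin; fromℕ<; fromℕ)
open import Data.Vec using (Vec; []; _∷_; lookup)
open import Data.Vec.Relation.Unary.All using (All)
open import Data.Product using (Σ; _×_; _,_)
open import Relation.Binary.PropositionalEquality using (_≡_; refl)
open import Relation.Nullary using (yes; no)
open import Function.Definitions using (Injective)

-- Signatures: function and predicate symbols with arities.
-- "finite or countable": both symbol sets inject into ℕ.

record Signature : Set₁ where
  field
    FSym   : Set
    PSym   : Set
    farity : FSym → ℕ
    parity : PSym → ℕ
    fcode  : FSym → ℕ
    pcode  : PSym → ℕ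
    fcode-inj : Injective _≡_ _≡_ fcode
    pcode-inj : Injective _≡_ _≡_ pcode

module _ (σ : Signature) where
  open Signature σ

  record FExpr : Set where
    constructor _⇐_$_
    field
      target : ℕ
      fsym   : FSym
      fargs  : Vec ℕ (farity fsym)

  record PExpr : Set where
    constructor _$$_
    field
      psym  : PSym
      pargs : Vec ℕ (parity psym)

  data Tree : Set where
    terminal : ℕ → Tree
    fnode    : FExpr → Tree → Tree
    pnode    : PExpr → (t₀ t₁ : Tree) → Tree

  record Scheme : Set where
    constructor scheme
    field
      arity : ℕ
      pos   : 1 ≤ arity
      graph : Tree

  depth : Tree → ℕ
  depth (terminal _)    = 0
  depth (fnode _ t)     = suc (depth t)
  depth (pnode _ t₀ t₁) = suc (depth t₀ ⊔ depth t₁)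

  h : Scheme → ℕ
  h S = depth (Scheme.graph S)

  data Term (n : ℕ) : Set where
    var : Fin n → Term n
    app : (f : FSym) → Vec (Term n) (farity f) → Term n

  TermSeq : ℕ → Set
  TermSeq n = ℕ → Term n

  M₁ : (n : ℕ) → 1 ≤ n → TermSeq n
  M₁ (suc k) _ i with i <? suc k
  ... | yes i<n = var (fromℕ< i<n)
  ... | no _    = var (fromℕ k)

  lookups : ∀ {n m} → TermSeq n → Vec ℕ m → Vec (Term n) m
  lookups M []       = []
  lookups M (l ∷ ls) = M l ∷ lookups M ls

  stepF : ∀ {n} → FExpr → TermSeq n → TermSeq n
  stepF (j ⇐ f $ ls) M i = if i ≡ᵇ j then app f (lookups M ls) else M i

  record Structure : Set₁ where
    field
      Carrier : Set
      fun  : (f : FSym) → Vec Carrier (farity f) → Carrier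
      pred : (r : PSym) → Vec Carrier (parity r) → Bool

  module _ (U : Structure) where
    open Structure U

    mutual
      evalTerm : ∀ {n} → Vec Carrier n → Term n → Carrier
      evalTerm a (var i)    = lookup a i
      evalTerm a (app f ts) = fun f (evalTerms a ts)

      evalTerms : ∀ {n m} → Vec Carrier n → Vec (Term n) m → Vec Carrier m
      evalTerms a []       = []
      evalTerms a (t ∷ ts) = evalTerm a t ∷ evalTerms a ts

    κ-value : ∀ {n} → Vec Carrier n → TermSeq n → PExpr → Bool
    κ-value a M (r $$ ls) = pred r (evalTerms a (lookups M ls))

    run : ∀ {n} → Vec Carrier n → TermSeq n → Tree → ℕ
    run a M (terminal t)    = t
    run a M (fnode e G)     = run a (stepF e M) G
    run a M (pnode e G₀ G₁) = if κ-value a M e then run a M G₁ else run a M G₀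

    φ : (S : Scheme) → Vec Carrier (Scheme.arity S) → ℕ
    φ (scheme n p G) a = run a (M₁ n p) G

  Equivalent : (S₁ S₂ : Scheme) → Scheme.arity S₁ ≡ Scheme.arity S₂ → Set₁
  Equivalent S₁ S₂ refl =
    (U : Structure) (a : Vec (Structure.Carrier U) (Scheme.arity S₁)) →
      φ U S₁ a ≡ φ U S₂ a

  data ChangeVars : Tree → Tree → Set where
    terminal : ∀ t → ChangeVars (terminal t) (terminal t)
    fnode : ∀ {j j′ f} {ls ls′ : Vec ℕ (farity f)} {G G′} →
            ChangeVars G G′ →
            ChangeVars (fnode (j ⇐ f $ ls) G) (fnode (j′ ⇐ f $ ls′) G′)
    pnode : ∀ {r} {ls ls′ : Vec ℕ (parity r)} {G₀ G₀′ G₁ G₁′} →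
            ChangeVars G₀ G₀′ → ChangeVars G₁ G₁′ →
            ChangeVars (pnode (r $$ ls) G₀ G₁) (pnode (r $$ ls′) G₀′ G₁′)

  data VarsIn (k : ℕ) : Tree → Set where
    terminal : ∀ t → VarsIn k (terminal t)
    fnode : ∀ {j f} {ls : Vec ℕ (farity f)} {G} →
            j < k → All (_< k) ls → VarsIn k G →
            VarsIn k (fnode (j ⇐ f $ ls) G)
    pnode : ∀ {r} {ls : Vec ℕ (parity r)} {G₀ G₁} →
            All (_< k) ls → VarsIn k G₀ → VarsIn k G₁ →
            VarsIn k (pnode (r $$ ls) G₀ G₁)

{-# OPTIONS --safe #-}
module Submission where

-- Give every function node a fresh variable of its own: along a path the function
-- nodes write x_n, x_{n+1}, … in turn instead of their original targets, and a
-- renaming ρ records which variable currently holds the term of each original one.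
-- Reads are redirected through ρ, so every computation follows the same path
-- with the same terms, while all variables stay below n + h(S₁) ≤ n + 2^h(S₁).
-- Initially ρ clamps i to min(i, n-1), matching M₁ = (x_0,…,x_{n-1},x_{n-1},…).

open import Defs
open import Data.Nat using (ℕ; zero; suc; _+_; _^_; _≤_; _<_; _<?_; _≡ᵇ_; _⊓_; s≤s; z<s; s<s)
open import Data.Nat.Properties
open import Data.Bool using (true; false; if_then_else_)
open import Data.Fin using (fromℕ<)
open import Data.Fin.Properties using (fromℕ-def; fromℕ<-cong)
open import Data.Vec using (Vec; []; _∷_; map)
open import Data.Vec.Relation.Unary.All using (All; universal)
open import Data.Vec.Relation.Unary.All.Properties using (map⁺)
open import Data.Product using (Σ; _×_; _,_)
open import Function using (_∘_)
open import Relation.Nullary using (yes; no)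
open import Relation.Binary.PropositionalEquality

n<2^n : ∀ n → n < 2 ^ n
n<2^n zero    = z<s
n<2^n (suc n) = ≤-<-trans (n<2^n n) (^-monoʳ-< 2 (s<s z<s) (n<1+n n))

≡ᵇ-refl : ∀ n → (n ≡ᵇ n) ≡ true
≡ᵇ-refl zero    = refl
≡ᵇ-refl (suc n) = ≡ᵇ-refl n

<⇒≡ᵇ≡false : ∀ {m n} → m < n → (m ≡ᵇ n) ≡ false
<⇒≡ᵇ≡false                 z<s       = refl
<⇒≡ᵇ≡false {suc _} {suc _} (s<s m<n) = <⇒≡ᵇ≡false m<n

assign : (ℕ → ℕ) → ℕ → ℕ → ℕ → ℕ
assign ρ j c i = if i ≡ᵇ j then c else ρ i

module _ (σ : Signature) where
  open Signature σ

  freshen : (ρ : ℕ → ℕ) (c : ℕ) → Tree σ → Tree σ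
  freshen ρ c (terminal t)             = terminal t
  freshen ρ c (fnode (j ⇐ f $ ls) G)   = fnode (c ⇐ f $ map ρ ls) (freshen (assign ρ j c) (suc c) G)
  freshen ρ c (pnode (r $$ ls) G₀ G₁) = pnode (r $$ map ρ ls) (freshen ρ c G₀) (freshen ρ c G₁)

  freshen-changeVars : ∀ ρ c G → ChangeVars σ G (freshen ρ c G)
  freshen-changeVars ρ c (terminal t)             = terminal t
  freshen-changeVars ρ c (fnode (j ⇐ f $ ls) G)   = fnode (freshen-changeVars _ _ G)
  freshen-changeVars ρ c (pnode (r $$ ls) G₀ G₁) =
    pnode (freshen-changeVars ρ c G₀) (freshen-changeVars ρ c G₁)

  assign-< : ∀ {ρ c} j → (∀ i → ρ i < c) → ∀ i → assign ρ j c i < suc c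
  assign-< j ρ<c i with i ≡ᵇ j
  ... | true  = ≤-refl
  ... | false = m≤n⇒m≤1+n (ρ<c i)

  map-< : ∀ {ρ c k m} → (∀ i → ρ i < c) → c ≤ k → (ls : Vec ℕ m) → All (_< k) (map ρ ls)
  map-< ρ<c c≤k ls = map⁺ (universal (λ i → <-≤-trans (ρ<c i) c≤k) ls)

  freshen-varsIn : ∀ {ρ c k} G → (∀ i → ρ i < c) → c + depth σ G ≤ k →
                   VarsIn σ k (freshen ρ c G)
  freshen-varsIn (terminal t) ρ<c c+d≤k = terminal t
  freshen-varsIn {c = c} (fnode (j ⇐ f $ ls) G) ρ<c c+d≤k =
    fnode (<-≤-trans (m<m+n c z<s) c+d≤k)
          (map-< ρ<c (≤-trans (m≤m+n c _) c+d≤k) ls)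
          (freshen-varsIn G (assign-< j ρ<c) (≤-trans (≤-reflexive (sym (+-suc c _))) c+d≤k))
  freshen-varsIn {c = c} (pnode (r $$ ls) G₀ G₁) ρ<c c+d≤k =
    pnode (map-< ρ<c (≤-trans (m≤m+n c _) c+d≤k) ls)
          (freshen-varsIn G₀ ρ<c (≤-trans (+-monoʳ-≤ c (m≤n⇒m≤1+n (m≤m⊔n _ _))) c+d≤k))
          (freshen-varsIn G₁ ρ<c (≤-trans (+-monoʳ-≤ c (m≤n⇒m≤1+n (m≤n⊔m _ _))) c+d≤k))

  module _ {n} {M : TermSeq σ n} (M′ : TermSeq σ n) {ρ : ℕ → ℕ} (M′∘ρ≗M : M′ ∘ ρ ≗ M) where

    lookups-map : ∀ {m} (ls : Vec ℕ m) → lookups σ M′ (map ρ ls) ≡ lookups σ M ls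
    lookups-map []       = refl
    lookups-map (l ∷ ls) = cong₂ _∷_ (M′∘ρ≗M l) (lookups-map ls)

    stepF-freshen : ∀ {c} j f (ls : Vec ℕ (farity f)) → (∀ i → ρ i < c) →
                    stepF σ (c ⇐ f $ map ρ ls) M′ ∘ assign ρ j c ≗ stepF σ (j ⇐ f $ ls) M
    stepF-freshen {c} j f ls ρ<c i with i ≡ᵇ j
    ... | true  rewrite ≡ᵇ-refl c           = cong (app f) (lookups-map ls)
    ... | false rewrite <⇒≡ᵇ≡false (ρ<c i) = M′∘ρ≗M i

  run-freshen : ∀ U {n} a {M} (M′ : TermSeq σ n) {ρ c} G → M′ ∘ ρ ≗ M → (∀ i → ρ i < c) →
                run σ U a M′ (freshen ρ c G) ≡ run σ U a M G
  run-freshen U a M′ (terminal t) M′∘ρ≗M ρ<c = refl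
  run-freshen U a M′ (fnode (j ⇐ f $ ls) G) M′∘ρ≗M ρ<c =
    run-freshen U a (stepF σ _ M′) G (stepF-freshen M′ M′∘ρ≗M j f ls ρ<c) (assign-< j ρ<c)
  run-freshen U a {M} M′ (pnode (r $$ ls) G₀ G₁) M′∘ρ≗M ρ<c
    rewrite lookups-map M′ M′∘ρ≗M ls
    with Structure.pred U r (evalTerms σ U a (lookups σ M ls))
  ... | true  = run-freshen U a M′ G₁ M′∘ρ≗M ρ<c
  ... | false = run-freshen U a M′ G₀ M′∘ρ≗M ρ<c

  M₁-var : ∀ k p i → M₁ σ (suc k) p i ≡ var (fromℕ< (s≤s (m⊓n≤n i k)))
  M₁-var k p i with i <? suc k
  ... | yes i<1+k = cong var (fromℕ<-cong _ _ (sym (m≤n⇒m⊓n≡m (≤-pred i<1+k))) _ _)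
  ... | no  i≮1+k = cong var (trans (fromℕ-def k)
                               (fromℕ<-cong _ _ (sym (m≥n⇒m⊓n≡n (<⇒≤ (≮⇒≥ i≮1+k)))) _ _))

  M₁∘clamp≗M₁ : ∀ k p → M₁ σ (suc k) p ∘ (_⊓ k) ≗ M₁ σ (suc k) p
  M₁∘clamp≗M₁ k p i =
    trans (M₁-var k p (i ⊓ k))
          (trans (cong var (fromℕ<-cong _ _ (m≤n⇒m⊓n≡m (m⊓n≤n i k)) _ _)) (sym (M₁-var k p i)))

lemma3 : (σ : Signature) (S₁ : Scheme σ) →
    Σ (Tree σ) λ G₂ →
      ChangeVars σ (Scheme.graph S₁) G₂ ×
      Equivalent σ S₁ (scheme (Scheme.arity S₁) (Scheme.pos S₁) G₂) refl ×
      VarsIn σ (Scheme.arity S₁ + 2 ^ h σ S₁) G₂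
lemma3 σ (scheme (suc k) p G) =
  freshen σ (_⊓ k) (suc k) G ,
  freshen-changeVars σ (_⊓ k) (suc k) G ,
  (λ U a → sym (run-freshen σ U a (M₁ σ (suc k) p) G (M₁∘clamp≗M₁ σ k p) clamp<n)) ,
  freshen-varsIn σ G clamp<n (+-monoʳ-≤ (suc k) (<⇒≤ (n<2^n (depth σ G))))
  where
    clamp<n : ∀ i → i ⊓ k < suc k
    clamp<n i = s≤s (m⊓n≤n i k)
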